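{- Let $w$ be a permutation. The closed interval poset $\overline{\mathcal{P}}(w)$ is a distributive lattice if and only if $w \in \mathfrak{S}_1 \cup \mathfrak{S}_2$.
   Context: For $w \in \mathfrak{S}_n$ in one-line notation $w(1)\cdots w(n)$, an interval of $w$ is a set of consecutive integers $[h,h+j]$ (possibly empty) with $\{w(t) : t \in [i,i+j]\} = [h,h+j]$ for some $i$. $\mathcal{P}(w)$ is the set of nonempty intervals of $w$ ordered by inclusion, and $\overline{\mathcal{P}}(w)$ is $\mathcal{P}(w)$ with a minimum element $\widehat{0}$ (the empty interval) adjoined; it is a lattice. -}

module Defs where

open import Data.Nat using (ℕ; _+_; _≤_; _<_)
open import Data.Fin using (Fin; toℕ)
open import Data.Fin.Permutation using (Permutation′; _⟨$⟩ʳ_)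
open import Data.Product using (Σ; ∃; _×_; _,_; proj₁)
open import Data.Maybe using (Maybe; just; nothing; map)
open import Data.Unit using (⊤)
open import Data.Empty using (⊥)
open import Function.Bundles using (_⇔_)
open import Relation.Binary.PropositionalEquality using (_≡_)

-- Positions and values are 0-based: w(0) ⋯ w(n-1), values in {0,…,n-1}.

_∈[_,_] : ℕ → ℕ → ℕ → Set
x ∈[ a , b ] = (a ≤ x) × (x ≤ b)

IsInterval : {n : ℕ} → Permutation′ n → ℕ → ℕ → Set
IsInterval {n} w h j =
  Σ ℕ λ i → (i + j < n) ×
    (∀ (x : ℕ) → (∃ λ (t : Fin n) → toℕ t ∈[ i , i + j ] × toℕ (w ⟨$⟩ʳ t) ≡ x)
                 ⇔ x ∈[ h , h + j ])

Interval : {n : ℕ} → Permutation′ n → Set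
Interval w = Σ (ℕ × ℕ) λ { (h , j) → IsInterval w h j }

-- Elements of the closed poset 𝒫̄(w): nothing = 0̂ (the empty interval).
ClosedP : {n : ℕ} → Permutation′ n → Set
ClosedP w = Maybe (Interval w)

carrier : {n : ℕ} {w : Permutation′ n} → ClosedP w → ℕ → Set
carrier nothing x = ⊥
carrier (just ((h , j) , _)) x = x ∈[ h , h + j ]

_⊑_ : {n : ℕ} {w : Permutation′ n} → ClosedP w → ClosedP w → Set
_⊑_ {n} {w} a b = ∀ x → carrier {n} {w} a x → carrier {n} {w} b x

_≈ᵢ_ : {n : ℕ} {w : Permutation′ n} → ClosedP w → ClosedP w → Set
_≈ᵢ_ a b = map proj₁ a ≡ map proj₁ b

-- For n ≤ 2 every subset of {0, …, n-1} is empty, a singleton or the whole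
-- range, and all of these are intervals of any w; so 𝒫̄(w) is the Boolean
-- lattice of these subsets, with union and intersection as join and meet.
-- For n ≥ 3 the singletons {0}, {1}, {2} are intervals and an interval
-- containing 0 and 2 contains 1, so {1} ≤ {0} ∨ {2} while {1} meets {0} and
-- {2} in 0̂; distributivity would then force {1} ≤ 0̂.
module Submission where

open import Defs
open import Data.Nat using (ℕ; _≤_)
open import Data.Fin.Permutation using (Permutation′)
open import Data.Product using (∃₂)
open import Data.Sum using (_⊎_)
open import Function.Bundles using (_⇔_)
open import Relation.Binary.PropositionalEquality using (_≡_)
open import Relation.Binary.Lattice.Structures using (IsDistributiveLattice)

open import Algebra.Core using (Op₂)
open import Data.Nat using (suc; zero; _+_; _<_; z≤n; s≤s; _≤?_)
open import Data.Nat.Properties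
  using (≤-refl; ≤-trans; ≤-antisym; ≤-reflexive; +-identityʳ; +-cancelˡ-≡; m≤m+n)
open import Data.Fin using (Fin; toℕ; fromℕ<)
open import Data.Fin.Properties using (toℕ-injective; toℕ<n; toℕ-fromℕ<; toℕ≤pred[n])
open import Data.Fin.Permutation using (_⟨$⟩ʳ_; _⟨$⟩ˡ_; inverseʳ)
open import Data.Product using (Σ; ∃; _×_; _,_; proj₁; proj₂)
open import Data.Product.Algebra using (×-distribˡ-⊎)
open import Data.Product.Function.NonDependent.Propositional using (_×-⇔_)
open import Data.Sum using (inj₁; inj₂; [_,_])
open import Data.Sum.Function.Propositional using (_⊎-⇔_)
open import Data.Maybe using (just; nothing)
open import Data.Empty using (⊥-elim)
open import Function.Bundles using (mk⇔; Equivalence)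
open import Function.Related.Propositional using (module EquationalReasoning; equivalence)
import Function.Properties.Equivalence as ⇔
open import Relation.Binary.Core using (Rel)
open import Relation.Binary.Definitions using (Antisymmetric)
open import Relation.Binary.PropositionalEquality using (refl; sym; trans; cong; cong₂; subst)
open import Relation.Binary.Structures using (IsPartialOrder)
open import Relation.Nullary using (¬_; yes; no; _×-dec_; _⊎-dec_)
open import Relation.Unary using (Decidable)

x≤y∨z⇒x≤u : ∀ {a ℓ₁ ℓ₂} {A : Set a} {_≈_ : Rel A ℓ₁} {_≤_ : Rel A ℓ₂} {_∨_ _∧_ : Op₂ A} →
            IsDistributiveLattice _≈_ _≤_ _∨_ _∧_ →
            ∀ {x y z u} → x ≤ (y ∨ z) → (x ∧ y) ≤ u → (x ∧ z) ≤ u → x ≤ u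
x≤y∨z⇒x≤u D {x} {y} {z} x≤y∨z x∧y≤u x∧z≤u =
  L.trans (L.∧-greatest L.refl x≤y∨z) (L.trans (L.reflexive (L.∧-distribˡ-∨ x y z)) (L.∨-least x∧y≤u x∧z≤u))
  where module L = IsDistributiveLattice D

left-endpoint∈ : ∀ h j → h ∈[ h , h + j ]
left-endpoint∈ h j = ≤-refl , m≤m+n h j

right-endpoint∈ : ∀ h j → (h + j) ∈[ h , h + j ]
right-endpoint∈ h j = m≤m+n h j , ≤-refl

∈[h,h+0]⇔≡ : ∀ {x h} → x ∈[ h , h + 0 ] ⇔ x ≡ h
∈[h,h+0]⇔≡ {x} {h} = mk⇔
  (λ (h≤x , x≤h+0) → ≤-antisym (≤-trans x≤h+0 (≤-reflexive (+-identityʳ h))) h≤x)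
  (λ { refl → left-endpoint∈ h 0 })

module _ {n : ℕ} (w : Permutation′ n) where

  private
    _≈_ _⊆_ : ClosedP w → ClosedP w → Set
    _≈_ = _≈ᵢ_ {n} {w}
    _⊆_ = _⊑_ {n} {w}

    _∋_ : ClosedP w → ℕ → Set
    _∋_ = carrier {n} {w}

  singleton-isInterval : ∀ {v} → v < n → IsInterval w v 0
  singleton-isInterval {v} v<n =
    toℕ p , subst (_< n) (sym (+-identityʳ (toℕ p))) (toℕ<n p) , λ x → mk⇔ (hit x) (reach x)
    where
    p : Fin n
    p = w ⟨$⟩ˡ fromℕ< v<n

    value-at-p : toℕ (w ⟨$⟩ʳ p) ≡ v
    value-at-p = trans (cong toℕ (inverseʳ w)) (toℕ-fromℕ< v<n)

    hit : ∀ x → (∃ λ t → toℕ t ∈[ toℕ p , toℕ p + 0 ] × toℕ (w ⟨$⟩ʳ t) ≡ x) → x ∈[ v , v + 0 ]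
    hit x (t , t∈ , wt≡x) with toℕ-injective (Equivalence.to ∈[h,h+0]⇔≡ t∈)
    ... | refl = Equivalence.from ∈[h,h+0]⇔≡ (trans (sym wt≡x) value-at-p)

    reach : ∀ x → x ∈[ v , v + 0 ] → ∃ λ t → toℕ t ∈[ toℕ p , toℕ p + 0 ] × toℕ (w ⟨$⟩ʳ t) ≡ x
    reach x x∈ = p , left-endpoint∈ (toℕ p) 0 , trans value-at-p (sym (Equivalence.to ∈[h,h+0]⇔≡ x∈))

  singleton : ∀ {v} → v < n → ClosedP w
  singleton {v} v<n = just ((v , 0) , singleton-isInterval v<n)

  singleton-∋⇔≡ : ∀ {v x} (v<n : v < n) → singleton v<n ∋ x ⇔ x ≡ v
  singleton-∋⇔≡ _ = ∈[h,h+0]⇔≡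

  ∋-bounded : ∀ e {x} → e ∋ x → x < n
  ∋-bounded (just (_ , _ , _ , values)) x∈ with Equivalence.from (values _) x∈
  ... | t , _ , refl = toℕ<n (w ⟨$⟩ʳ t)

  ∋-convex : ∀ e {x y z} → e ∋ x → e ∋ z → x ≤ y → y ≤ z → e ∋ y
  ∋-convex (just _) (h≤x , _) (_ , z≤top) x≤y y≤z = ≤-trans h≤x x≤y , ≤-trans y≤z z≤top

  _∋?_ : ∀ e → Decidable (e ∋_)
  nothing ∋? x = no λ ()
  just ((h , j) , _) ∋? x = (h ≤? x) ×-dec (x ≤? h + j)

  ⊆-antisym : Antisymmetric _≈_ _⊆_
  ⊆-antisym {nothing} {nothing} _ _ = refl
  ⊆-antisym {nothing} {just ((h , j) , _)} _ b⊆∅ = ⊥-elim (b⊆∅ h (left-endpoint∈ h j))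
  ⊆-antisym {just ((h , j) , _)} {nothing} a⊆∅ _ = ⊥-elim (a⊆∅ h (left-endpoint∈ h j))
  ⊆-antisym {just ((h , j) , _)} {just ((h′ , j′) , _)} a⊆b b⊆a =
    cong just (cong₂ _,_ h≡h′ (+-cancelˡ-≡ h j j′ (trans h+j≡h′+j′ (cong (_+ j′) (sym h≡h′)))))
    where
    h≡h′ : h ≡ h′
    h≡h′ = ≤-antisym (proj₁ (b⊆a h′ (left-endpoint∈ h′ j′))) (proj₁ (a⊆b h (left-endpoint∈ h j)))

    h+j≡h′+j′ : h + j ≡ h′ + j′
    h+j≡h′+j′ = ≤-antisym (proj₂ (a⊆b (h + j) (right-endpoint∈ h j))) (proj₂ (b⊆a (h′ + j′) (right-endpoint∈ h′ j′)))

  ⊆-isPartialOrder : IsPartialOrder _≈_ _⊆_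
  ⊆-isPartialOrder = record
    { isPreorder = record
      { isEquivalence = record { refl = refl ; sym = sym ; trans = trans }
      ; reflexive = λ { {nothing} {nothing} _ _ () ; {just _} {just _} refl _ x∈ → x∈ }
      ; trans = λ a⊆b b⊆c x x∈ → b⊆c x (a⊆b x x∈)
      }
    ; antisym = ⊆-antisym
    }

  ≈-from-∋⇔ : ∀ {a b} → (∀ x → a ∋ x ⇔ b ∋ x) → a ≈ b
  ≈-from-∋⇔ a⇔b = ⊆-antisym (λ x → Equivalence.to (a⇔b x)) (λ x → Equivalence.from (a⇔b x))

  union-intersection⇒isDistributiveLattice :
    (_∪_ _∩_ : Op₂ (ClosedP w)) →
    (∀ a b x → (a ∪ b) ∋ x ⇔ (a ∋ x ⊎ b ∋ x)) →
    (∀ a b x → (a ∩ b) ∋ x ⇔ (a ∋ x × b ∋ x)) →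
    IsDistributiveLattice _≈_ _⊆_ _∪_ _∩_
  union-intersection⇒isDistributiveLattice _∪_ _∩_ ∪-∋ ∩-∋ = record
    { isLattice = record
      { isPartialOrder = ⊆-isPartialOrder
      ; supremum = λ a b →
          (λ x x∈a → Equivalence.from (∪-∋ a b x) (inj₁ x∈a)) ,
          (λ x x∈b → Equivalence.from (∪-∋ a b x) (inj₂ x∈b)) ,
          λ c a⊆c b⊆c x x∈ → [ a⊆c x , b⊆c x ] (Equivalence.to (∪-∋ a b x) x∈)
      ; infimum = λ a b →
          (λ x x∈ → proj₁ (Equivalence.to (∩-∋ a b x) x∈)) ,
          (λ x x∈ → proj₂ (Equivalence.to (∩-∋ a b x) x∈)) ,
          λ c c⊆a c⊆b x x∈ → Equivalence.from (∩-∋ a b x) (c⊆a x x∈ , c⊆b x x∈)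
      }
    ; ∧-distribˡ-∨ = λ a b c → ≈-from-∋⇔ λ x →
        let open EquationalReasoning {k = equivalence} in begin
          (a ∩ (b ∪ c)) ∋ x                   ∼⟨ ∩-∋ a (b ∪ c) x ⟩
          (a ∋ x × (b ∪ c) ∋ x)               ∼⟨ ⇔.refl ×-⇔ ∪-∋ b c x ⟩
          (a ∋ x × (b ∋ x ⊎ c ∋ x))           ↔⟨ ×-distribˡ-⊎ _ (a ∋ x) (b ∋ x) (c ∋ x) ⟩
          ((a ∋ x × b ∋ x) ⊎ (a ∋ x × c ∋ x)) ∼⟨ ⇔.sym (∩-∋ a b x) ⊎-⇔ ⇔.sym (∩-∋ a c x) ⟩
          ((a ∩ b) ∋ x ⊎ (a ∩ c) ∋ x)         ∼⟨ ⇔.sym (∪-∋ (a ∩ b) (a ∩ c) x) ⟩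
          ((a ∩ b) ∪ (a ∩ c)) ∋ x             ∎
    }

  AllSubsetsAreIntervals : Set₁
  AllSubsetsAreIntervals =
    (P : ℕ → Set) → Decidable P → Σ (ClosedP w) λ e → ∀ x → e ∋ x ⇔ (x < n × P x)

  realises-if-agrees-below : ∀ e {P : ℕ → Set} → (∀ x → x < n → e ∋ x ⇔ P x) →
                             ∀ x → e ∋ x ⇔ (x < n × P x)
  realises-if-agrees-below e agree x = mk⇔
    (λ x∈ → ∋-bounded e x∈ , Equivalence.to (agree x (∋-bounded e x∈)) x∈)
    (λ (x<n , Px) → Equivalence.from (agree x x<n) Px)

  allSubsetsAreIntervals⇒isDistributiveLattice :
    AllSubsetsAreIntervals → ∃₂ λ _∨_ _∧_ → IsDistributiveLattice _≈_ _⊆_ _∨_ _∧_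
  allSubsetsAreIntervals⇒isDistributiveLattice realise =
    _∪_ , _∩_ , union-intersection⇒isDistributiveLattice _∪_ _∩_ ∪-∋ ∩-∋
    where
    realised-∋⇔ : ∀ {P} (P? : Decidable P) → (∀ {x} → P x → x < n) →
                  ∀ x → proj₁ (realise P P?) ∋ x ⇔ P x
    realised-∋⇔ {P} P? bounded x = mk⇔
      (λ x∈ → proj₂ (Equivalence.to (proj₂ (realise P P?) x) x∈))
      (λ Px → Equivalence.from (proj₂ (realise P P?) x) (bounded Px , Px))

    _∪_ _∩_ : Op₂ (ClosedP w)
    a ∪ b = proj₁ (realise _ (λ x → (a ∋? x) ⊎-dec (b ∋? x)))
    a ∩ b = proj₁ (realise _ (λ x → (a ∋? x) ×-dec (b ∋? x)))

    ∪-∋ : ∀ a b x → (a ∪ b) ∋ x ⇔ (a ∋ x ⊎ b ∋ x)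
    ∪-∋ a b = realised-∋⇔ _ [ ∋-bounded a , ∋-bounded b ]

    ∩-∋ : ∀ a b x → (a ∩ b) ∋ x ⇔ (a ∋ x × b ∋ x)
    ∩-∋ a b = realised-∋⇔ _ (λ (x∈a , _) → ∋-bounded a x∈a)

  ¬isDistributiveLattice : 3 ≤ n → ∀ {_∨_ _∧_} → ¬ IsDistributiveLattice _≈_ _⊆_ _∨_ _∧_
  ¬isDistributiveLattice 3≤n {_∨_} {_∧_} D =
    x≤y∨z⇒x≤u D {[1]} {[0]} {[2]} {nothing} [1]⊆[0]∨[2] (disjoint 1<n 0<n λ ()) (disjoint 1<n 2<n λ ())
      1 (v∈singleton 1<n)
    where
    open IsDistributiveLattice D using (x≤x∨y; y≤x∨y; x∧y≤x; x∧y≤y)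

    0<n : 0 < n
    0<n = ≤-trans (s≤s z≤n) 3≤n
    1<n : 1 < n
    1<n = ≤-trans (s≤s (s≤s z≤n)) 3≤n
    2<n : 2 < n
    2<n = 3≤n

    v∈singleton : ∀ {v} (v<n : v < n) → singleton v<n ∋ v
    v∈singleton v<n = Equivalence.from (singleton-∋⇔≡ v<n) refl

    [0] [1] [2] : ClosedP w
    [0] = singleton 0<n
    [1] = singleton 1<n
    [2] = singleton 2<n

    [1]⊆[0]∨[2] : [1] ⊆ ([0] ∨ [2])
    [1]⊆[0]∨[2] x x∈ with Equivalence.to (singleton-∋⇔≡ 1<n) x∈
    ... | refl = ∋-convex ([0] ∨ [2]) (x≤x∨y [0] [2] 0 (v∈singleton 0<n)) (y≤x∨y [0] [2] 2 (v∈singleton 2<n))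
                          z≤n (s≤s z≤n)

    disjoint : ∀ {u v} (u<n : u < n) (v<n : v < n) → ¬ u ≡ v → (singleton u<n ∧ singleton v<n) ⊆ nothing
    disjoint u<n v<n u≢v x x∈ = u≢v (trans (sym (Equivalence.to (singleton-∋⇔≡ u<n) (x∧y≤x _ _ x x∈)))
                                           (Equivalence.to (singleton-∋⇔≡ v<n) (x∧y≤y _ _ x x∈)))

full-isInterval : ∀ {k} (w : Permutation′ (suc k)) → IsInterval w 0 k
full-isInterval w = 0 , ≤-refl , λ x → mk⇔
  (λ { (t , _ , refl) → z≤n , toℕ≤pred[n] (w ⟨$⟩ʳ t) })
  (λ (_ , x≤k) → w ⟨$⟩ˡ fromℕ< (s≤s x≤k) , (z≤n , toℕ≤pred[n] _) ,
                 trans (cong toℕ (inverseʳ w)) (toℕ-fromℕ< (s≤s x≤k)))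

full : ∀ {k} (w : Permutation′ (suc k)) → ClosedP w
full {k} w = just ((0 , k) , full-isInterval w)

module _ {A B : Set} where

  both⇔ : A → B → A ⇔ B
  both⇔ a b = mk⇔ (λ _ → b) (λ _ → a)

  neither⇔ : ¬ A → ¬ B → A ⇔ B
  neither⇔ ¬a ¬b = mk⇔ (λ a → ⊥-elim (¬a a)) (λ b → ⊥-elim (¬b b))

agree-below-1 : ∀ {C P : ℕ → Set} → C 0 ⇔ P 0 → ∀ x → x < 1 → C x ⇔ P x
agree-below-1 c0 zero    _             = c0
agree-below-1 _  (suc _) (s≤s ())

agree-below-2 : ∀ {C P : ℕ → Set} → C 0 ⇔ P 0 → C 1 ⇔ P 1 → ∀ x → x < 2 → C x ⇔ P x
agree-below-2 c0 _  zero          _                   = c0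
agree-below-2 _  c1 (suc zero)    _                   = c1
agree-below-2 _  _  (suc (suc _)) (s≤s (s≤s ()))

allSubsetsAreIntervals₁ : (w : Permutation′ 1) → AllSubsetsAreIntervals w
allSubsetsAreIntervals₁ w P P? with P? 0
... | yes P0 = full w , realises-if-agrees-below w (full w) (agree-below-1 (both⇔ (z≤n , z≤n) P0))
... | no ¬P0 = nothing , realises-if-agrees-below w nothing (agree-below-1 (neither⇔ (λ ()) ¬P0))

allSubsetsAreIntervals₂ : (w : Permutation′ 2) → AllSubsetsAreIntervals w
allSubsetsAreIntervals₂ w P P? with P? 0 | P? 1
... | no ¬P0 | no ¬P1 = nothing , realises-if-agrees-below w nothing
  (agree-below-2 (neither⇔ (λ ()) ¬P0) (neither⇔ (λ ()) ¬P1))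
... | yes P0 | no ¬P1 = singleton w (s≤s z≤n) , realises-if-agrees-below w (singleton w (s≤s z≤n))
  (agree-below-2 (both⇔ (z≤n , z≤n) P0) (neither⇔ (λ { (_ , ()) }) ¬P1))
... | no ¬P0 | yes P1 = singleton w (s≤s (s≤s z≤n)) , realises-if-agrees-below w (singleton w (s≤s (s≤s z≤n)))
  (agree-below-2 (neither⇔ (λ { (() , _) }) ¬P0) (both⇔ (s≤s z≤n , s≤s z≤n) P1))
... | yes P0 | yes P1 = full w , realises-if-agrees-below w (full w)
  (agree-below-2 (both⇔ (z≤n , z≤n) P0) (both⇔ (z≤n , s≤s z≤n) P1))

theorem3p11 : ∀ (n : ℕ) → 1 ≤ n → (w : Permutation′ n) →
    (∃₂ λ _∨_ _∧_ → IsDistributiveLattice (_≈ᵢ_ {n} {w}) (_⊑_ {n} {w}) _∨_ _∧_)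
      ⇔ (n ≡ 1 ⊎ n ≡ 2)
theorem3p11 0 () _
theorem3p11 1 _ w = mk⇔ (λ _ → inj₁ refl)
  (λ _ → allSubsetsAreIntervals⇒isDistributiveLattice w (allSubsetsAreIntervals₁ w))
theorem3p11 2 _ w = mk⇔ (λ _ → inj₂ refl)
  (λ _ → allSubsetsAreIntervals⇒isDistributiveLattice w (allSubsetsAreIntervals₂ w))
theorem3p11 (suc (suc (suc m))) _ w = mk⇔
  (λ (_ , _ , D) → ⊥-elim (¬isDistributiveLattice w (s≤s (s≤s (s≤s z≤n))) D))
  (λ { (inj₁ ()) ; (inj₂ ()) })
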